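{- Let $G$ be a connected finite simple graph on at least three vertices, and let $uv$ be a vertex of the $1$-shunt intersection graph $A_1(G)$. Let $m_u$ (resp. $m_v$) denote the number of neighbours of $u$ other than $v$ (resp. of $v$ other than $u$) that are pendant vertices (degree $1$) of $G$. Then $$\deg_{A_1(G)}(uv)=\begin{cases}2(\deg_G(u)+\deg_G(v)-2)-(m_u+m_v)+1, & \text{if } \deg_G(u)>1 \text{ and } \deg_G(v)>1,\\ 2(\deg_G(v)-1)-m_v, & \text{if } \deg_G(u)=1.\end{cases}$$
   Context: A $1$-arc of $G$ is an ordered pair $(u,v)$ with $uv\in E(G)$, written $uv$. A $1$-arc $uv$ can be shunted onto the $1$-arc $vw$ if $w\neq u$ and $vw\in E(G)$. The graph $A_1(G)$ has as vertices the $1$-arcs of $G$ that can be shunted onto some other $1$-arc; two distinct vertices are adjacent iff the corresponding $1$-arcs share at least one vertex of $G$. -}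

module Defs where

open import Data.Nat using (ℕ; _≟_)
open import Data.Fin using (Fin)
open import Data.Fin.Properties using (any?) renaming (_≟_ to _≟ᶠ_)
open import Data.List using (List; length; filter; allFin; cartesianProduct)
open import Data.Product using (_×_; _,_; ∃; proj₁; proj₂)
open import Data.Sum using (_⊎_)
open import Relation.Nullary using (¬_; Dec)
open import Relation.Nullary.Decidable using (_×-dec_; _⊎-dec_; ¬?)
open import Relation.Binary.PropositionalEquality using (_≡_; _≢_)
open import Relation.Binary.Construct.Closure.ReflexiveTransitive using (Star)

record Graph (n : ℕ) : Set₁ where
  field
    Adj   : Fin n → Fin n → Set
    adj?  : (x y : Fin n) → Dec (Adj x y)
    sym   : ∀ {x y} → Adj x y → Adj y x
    irrefl : ∀ {x} → ¬ Adj x x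

module _ {n : ℕ} (G : Graph n) where
  open Graph G

  Connected : Set
  Connected = (x y : Fin n) → Star Adj x y

  deg : Fin n → ℕ
  deg x = length (filter (adj? x) (allFin n))

  -- the 1-arc xy (given Adj x y) can be shunted onto some 1-arc yw with w ≠ x
  Shuntable : Fin n → Fin n → Set
  Shuntable x y = ∃ λ w → w ≢ x × Adj y w

  shuntable? : (x y : Fin n) → Dec (Shuntable x y)
  shuntable? x y = any? (λ w → ¬? (w ≟ᶠ x) ×-dec adj? y w)

  -- vertices of A₁(G): 1-arcs that can be shunted onto some other 1-arc
  A1Vertex : Fin n → Fin n → Set
  A1Vertex x y = Adj x y × Shuntable x y

  a1Vertex? : (x y : Fin n) → Dec (A1Vertex x y)
  a1Vertex? x y = adj? x y ×-dec shuntable? x y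

  A1Neighbour : Fin n → Fin n → Fin n × Fin n → Set
  A1Neighbour u v (x , y) =
    A1Vertex x y × ¬ (x ≡ u × y ≡ v) × ((x ≡ u ⊎ x ≡ v) ⊎ (y ≡ u ⊎ y ≡ v))

  a1Neighbour? : (u v : Fin n) (p : Fin n × Fin n) → Dec (A1Neighbour u v p)
  a1Neighbour? u v (x , y) =
    a1Vertex? x y ×-dec ¬? ((x ≟ᶠ u) ×-dec (y ≟ᶠ v))
      ×-dec (((x ≟ᶠ u) ⊎-dec (x ≟ᶠ v)) ⊎-dec ((y ≟ᶠ u) ⊎-dec (y ≟ᶠ v)))

  degA1 : Fin n → Fin n → ℕ
  degA1 u v = length (filter (a1Neighbour? u v) (cartesianProduct (allFin n) (allFin n)))

  pendantNbrs : Fin n → Fin n → ℕ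
  pendantNbrs u v =
    length (filter (λ x → adj? u x ×-dec ¬? (x ≟ᶠ v) ×-dec (deg x ≟ 1)) (allFin n))

-- A 1-arc xy is a vertex of A₁(G) exactly when its head y is not pendant, and it is
-- adjacent to uv exactly when it meets {u, v}. Group these arcs by their tail x. Tail u
-- gives the non-pendant neighbours of u other than v, i.e. deg u − 1 − m_u; tail v gives
-- deg v − m_v − [u pendant]; any other tail x gives [xu ∈ E, u not pendant] + [xv ∈ E],
-- and summed over x ∉ {u, v} these are (deg u − 1)[u not pendant] + (deg v − 1). Adding up,
--   deg_{A₁}(uv) + m_u + m_v + 3 + [u pendant] · deg u = 2 (deg u + deg v),
-- which gives both cases.

module Submission where

open import Defs
open import Data.Nat using (ℕ; _≤_; _<_)
open import Data.Fin using (Fin)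
open import Data.Product using (_×_)
open import Relation.Binary.PropositionalEquality using (_≡_)

module Counting where

  open import Level using (Level)
  open import Data.Bool using (true; false; if_then_else_)
  open import Data.Nat using (zero; suc; _+_; _*_)
  open import Data.Nat.Properties
    using (+-*-semiring; +-assoc; +-identityʳ; *-identityʳ; *-zeroʳ; *-distribˡ-+; *-distribʳ-+; *-assoc; 1+n≢0)
  open import Data.Fin using (zero; suc; _≟_)
  open import Data.List using (List; []; _∷_; _++_; map; filter; length; tabulate; cartesianProduct)
  open import Data.List.Properties using (filter-++; length-++)
  open import Data.Product as Product using (_,_; ∃)
  open import Data.Sum using (_⊎_; [_,_])
  open import Function using (_∘_; id)
  open import Relation.Nullary using (Dec; yes; no; does; ¬_; contradiction)
  open import Relation.Nullary.Decidable using (_×-dec_; ¬?)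
  open import Relation.Unary using (Pred; Decidable; _≐_)
  open import Relation.Unary.Properties using (_∩?_; ∁?)
  open import Relation.Binary.PropositionalEquality
    using (_≢_; refl; sym; trans; cong; cong₂; module ≡-Reasoning)
  open import Algebra.Properties.Semiring.Sum +-*-semiring
    using (sum; sum-cong-≗; sum-replicate-zero; ∑-distrib-+; *-distribˡ-sum)

  open ≡-Reasoning

  private variable
    ℓ ℓ′ : Level
    A B : Set ℓ
    m n : ℕ

  𝟙 : Dec A → ℕ
  𝟙 d = if does d then 1 else 0

  𝟙-yes : (d : Dec A) → A → 𝟙 d ≡ 1
  𝟙-yes (yes _) _  = refl
  𝟙-yes (no ¬x) x = contradiction x ¬x

  𝟙-no : (d : Dec A) → ¬ A → 𝟙 d ≡ 0
  𝟙-no (yes x) ¬x = contradiction x ¬x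
  𝟙-no (no _)  _  = refl

  𝟙-cong : (d : Dec A) (e : Dec B) → (A → B) → (B → A) → 𝟙 d ≡ 𝟙 e
  𝟙-cong d (yes y) _   B⇒A = 𝟙-yes d (B⇒A y)
  𝟙-cong d (no ¬y) A⇒B _   = 𝟙-no d (¬y ∘ A⇒B)

  𝟙-× : (d : Dec A) (e : Dec B) → 𝟙 (d ×-dec e) ≡ 𝟙 d * 𝟙 e
  𝟙-× (yes _) (yes _) = refl
  𝟙-× (yes _) (no _)  = refl
  𝟙-× (no _)  _       = refl

  𝟙-×-¬ : (d : Dec A) (e : Dec B) → 𝟙 (d ×-dec ¬? e) + 𝟙 e * 𝟙 d ≡ 𝟙 d
  𝟙-×-¬ (yes _) (yes _) = refl
  𝟙-×-¬ (yes _) (no _)  = refl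
  𝟙-×-¬ (no _)  (yes _) = refl
  𝟙-×-¬ (no _)  (no _)  = refl

  𝟙-+-𝟙-¬ : (d : Dec A) → 𝟙 d + 𝟙 (¬? d) ≡ 1
  𝟙-+-𝟙-¬ (yes _) = refl
  𝟙-+-𝟙-¬ (no _)  = refl

  ∑-split : {Q : Pred (Fin n) ℓ} (Q? : Decidable Q) (f : Fin n → ℕ) →
            sum f ≡ sum (λ i → f i * 𝟙 (Q? i)) + sum (λ i → f i * 𝟙 (∁? Q? i))
  ∑-split Q? f = trans (sum-cong-≗ split) (∑-distrib-+ (λ i → f i * 𝟙 (Q? i)) (λ i → f i * 𝟙 (∁? Q? i)))
    where
    split : ∀ i → f i ≡ f i * 𝟙 (Q? i) + f i * 𝟙 (∁? Q? i)
    split i = begin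
      f i                                    ≡⟨ *-identityʳ (f i) ⟨
      f i * 1                                ≡⟨ cong (f i *_) (𝟙-+-𝟙-¬ (Q? i)) ⟨
      f i * (𝟙 (Q? i) + 𝟙 (∁? Q? i))         ≡⟨ *-distribˡ-+ (f i) _ _ ⟩
      f i * 𝟙 (Q? i) + f i * 𝟙 (∁? Q? i)    ∎

  ∑-δ : (a : Fin n) (f : Fin n → ℕ) → sum (λ i → f i * 𝟙 (i ≟ a)) ≡ f a
  ∑-δ {suc n} zero f = begin
    f zero * 1 + sum (λ i → f (suc i) * 0)  ≡⟨ cong₂ _+_ (*-identityʳ (f zero)) (sum-cong-≗ {n} (*-zeroʳ ∘ f ∘ suc)) ⟩
    f zero + sum {n} (λ _ → 0)              ≡⟨ cong (f zero +_) (sum-replicate-zero n) ⟩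
    f zero + 0                              ≡⟨ +-identityʳ (f zero) ⟩
    f zero                                  ∎
  ∑-δ {suc n} (suc a) f = begin
    f zero * 0 + sum (λ i → f (suc i) * 𝟙 (i ≟ a))  ≡⟨ cong₂ _+_ (*-zeroʳ (f zero)) (∑-δ a (f ∘ suc)) ⟩
    f (suc a)                                       ∎

  _without_ : (Fin n → ℕ) → Fin n → Fin n → ℕ
  (f without a) i = f i * 𝟙 (¬? (i ≟ a))

  infixl 5 _without_

  ∑-remove : (a : Fin n) (f : Fin n → ℕ) → sum f ≡ f a + sum (f without a)
  ∑-remove a f = trans (∑-split (_≟ a) f) (cong (_+ sum (f without a)) (∑-δ a f))

  ∑-except : Fin n → Fin n → (Fin n → ℕ) → ℕ
  ∑-except a b f = sum (f without a without b)

  ∑-remove-two : {a b : Fin n} → a ≢ b → (f : Fin n → ℕ) → sum f ≡ f a + f b + ∑-except a b f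
  ∑-remove-two {a = a} {b} a≢b f = begin
    sum f                                              ≡⟨ ∑-remove a f ⟩
    f a + sum (f without a)                            ≡⟨ cong (f a +_) (∑-remove b (f without a)) ⟩
    f a + ((f without a) b + ∑-except a b f)           ≡⟨ cong (λ x → f a + (x + ∑-except a b f)) fb ⟩
    f a + (f b + ∑-except a b f)                       ≡⟨ +-assoc (f a) (f b) _ ⟨
    f a + f b + ∑-except a b f                         ∎
    where
    fb : (f without a) b ≡ f b
    fb = trans (cong (f b *_) (𝟙-yes (¬? (b ≟ a)) (a≢b ∘ sym))) (*-identityʳ (f b))

  without-cong : {f g : Fin n → ℕ} (a i : Fin n) → (i ≢ a → f i ≡ g i) → (f without a) i ≡ (g without a) i
  without-cong {f = f} {g} a i f≡g with i ≟ a
  ... | yes _   = trans (*-zeroʳ (f i)) (sym (*-zeroʳ (g i)))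
  ... | no i≢a = cong (_* 1) (f≡g i≢a)

  module _ {a b : Fin n} where

    ∑-except-cong : {f g : Fin n → ℕ} → (∀ i → i ≢ a → i ≢ b → f i ≡ g i) →
                    ∑-except a b f ≡ ∑-except a b g
    ∑-except-cong {f} {g} f≡g = sum-cong-≗ λ i →
      without-cong {f = f without a} {g without a} b i λ i≢b →
      without-cong {f = f} {g} a i λ i≢a → f≡g i i≢a i≢b

    ∑-except-+ : (f g : Fin n → ℕ) → ∑-except a b (λ i → f i + g i) ≡ ∑-except a b f + ∑-except a b g
    ∑-except-+ f g = trans (sum-cong-≗ distrib) (∑-distrib-+ (f without a without b) (g without a without b))
      where
      distrib : ∀ i → ((λ j → f j + g j) without a without b) i ≡ (f without a without b) i + (g without a without b) i
      distrib i = trans (cong (_* 𝟙 (¬? (i ≟ b))) (*-distribʳ-+ (𝟙 (¬? (i ≟ a))) (f i) (g i)))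
                        (*-distribʳ-+ (𝟙 (¬? (i ≟ b))) (f i * 𝟙 (¬? (i ≟ a))) (g i * 𝟙 (¬? (i ≟ a))))

    ∑-except-* : (c : ℕ) (f : Fin n → ℕ) → ∑-except a b (λ i → c * f i) ≡ c * ∑-except a b f
    ∑-except-* c f = trans (sum-cong-≗ assoc) (sym (*-distribˡ-sum c (f without a without b)))
      where
      assoc : ∀ i → ((λ j → c * f j) without a without b) i ≡ c * (f without a without b) i
      assoc i = trans (cong (_* 𝟙 (¬? (i ≟ b))) (*-assoc c (f i) (𝟙 (¬? (i ≟ a)))))
                      (*-assoc c (f i * 𝟙 (¬? (i ≟ a))) (𝟙 (¬? (i ≟ b))))

  count : {P : Pred (Fin n) ℓ} → Decidable P → ℕ
  count P? = sum (λ i → 𝟙 (P? i))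

  count-cong : {P : Pred (Fin n) ℓ} {Q : Pred (Fin n) ℓ′} (P? : Decidable P) (Q? : Decidable Q) →
               P ≐ Q → count P? ≡ count Q?
  count-cong P? Q? (P⊆Q , Q⊆P) = sum-cong-≗ λ i → 𝟙-cong (P? i) (Q? i) P⊆Q Q⊆P

  module _ {P : Pred (Fin n) ℓ} (P? : Decidable P) where

    count-split : {Q : Pred (Fin n) ℓ′} (Q? : Decidable Q) →
                  count P? ≡ count (P? ∩? Q?) + count (P? ∩? ∁? Q?)
    count-split Q? = trans (∑-split Q? (𝟙 ∘ P?))
      (sym (cong₂ _+_ (sum-cong-≗ λ i → 𝟙-× (P? i) (Q? i)) (sum-cong-≗ λ i → 𝟙-× (P? i) (¬? (Q? i)))))

    count-∩-≡ : (a : Fin n) → count (P? ∩? (_≟ a)) ≡ 𝟙 (P? a)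
    count-∩-≡ a = trans (sum-cong-≗ λ i → 𝟙-× (P? i) (i ≟ a)) (∑-δ a (𝟙 ∘ P?))

    count-≢0 : ∀ {a} → P a → count P? ≢ 0
    count-≢0 {a} Pa count≡0 = 1+n≢0 (begin
      1 + count (P? ∩? ∁? (_≟ a))                      ≡⟨ cong (_+ count (P? ∩? ∁? (_≟ a))) (𝟙-yes (P? a) Pa) ⟨
      𝟙 (P? a) + count (P? ∩? ∁? (_≟ a))               ≡⟨ cong (_+ count (P? ∩? ∁? (_≟ a))) (count-∩-≡ a) ⟨
      count (P? ∩? (_≟ a)) + count (P? ∩? ∁? (_≟ a))   ≡⟨ count-split (_≟ a) ⟨
      count P?                                         ≡⟨ count≡0 ⟩
      0                                                ∎)

    count-two-points : {a b : Fin n} → a ≢ b → (∀ {i} → P i → i ≡ a ⊎ i ≡ b) →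
                       count P? ≡ 𝟙 (P? a) + 𝟙 (P? b)
    count-two-points {a} {b} a≢b P⊆ab = begin
      count P?                                         ≡⟨ count-split (_≟ a) ⟩
      count (P? ∩? (_≟ a)) + count (P? ∩? ∁? (_≟ a))   ≡⟨ cong₂ _+_ (count-∩-≡ a) (count-cong (P? ∩? ∁? (_≟ a)) (P? ∩? (_≟ b)) off-a⇔b) ⟩
      𝟙 (P? a) + count (P? ∩? (_≟ b))                  ≡⟨ cong (𝟙 (P? a) +_) (count-∩-≡ b) ⟩
      𝟙 (P? a) + 𝟙 (P? b)                              ∎
      where
      off-a⇔b : (λ i → P i × i ≢ a) ≐ (λ i → P i × i ≡ b)
      off-a⇔b = (λ (Pi , i≢a) → Pi , [ (λ i≡a → contradiction i≡a i≢a) , id ] (P⊆ab Pi))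
              , (λ { (Pi , refl) → Pi , a≢b ∘ sym })

  count≢0⇒∃ : {P : Pred (Fin n) ℓ} (P? : Decidable P) → count P? ≢ 0 → ∃ P
  count≢0⇒∃ {n = zero}  P? count≢0 = contradiction refl count≢0
  count≢0⇒∃ {n = suc n} P? count≢0 with P? zero
  ... | yes P0 = zero , P0
  ... | no _   = Product.map suc id (count≢0⇒∃ (P? ∘ suc) count≢0)

  length-filter-tabulate : {P : Pred A ℓ} (P? : Decidable P) (f : Fin n → A) →
                           length (filter P? (tabulate f)) ≡ sum (λ i → 𝟙 (P? (f i)))
  length-filter-tabulate {n = zero}  P? f = refl
  length-filter-tabulate {n = suc n} P? f with does (P? (f zero))
  ... | true  = cong suc (length-filter-tabulate P? (f ∘ suc))
  ... | false = length-filter-tabulate P? (f ∘ suc)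

  length-filter-map : {P : Pred B ℓ} (P? : Decidable P) (g : A → B) (xs : List A) →
                      length (filter P? (map g xs)) ≡ length (filter (P? ∘ g) xs)
  length-filter-map P? g []       = refl
  length-filter-map P? g (x ∷ xs) with does (P? (g x))
  ... | true  = cong suc (length-filter-map P? g xs)
  ... | false = length-filter-map P? g xs

  length-filter-cartesianProduct :
    {P : Pred (A × B) ℓ} (P? : Decidable P) (f : Fin m → A) (ys : List B) →
    length (filter P? (cartesianProduct (tabulate f) ys)) ≡
    sum (λ i → length (filter (λ y → P? (f i , y)) ys))
  length-filter-cartesianProduct {m = zero}  P? f ys = refl
  length-filter-cartesianProduct {m = suc m} P? f ys = begin
    length (filter P? (map (f zero ,_) ys ++ rest))                   ≡⟨ cong length (filter-++ P? (map (f zero ,_) ys) rest) ⟩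
    length (filter P? (map (f zero ,_) ys) ++ filter P? rest)        ≡⟨ length-++ (filter P? (map (f zero ,_) ys)) ⟩
    length (filter P? (map (f zero ,_) ys)) + length (filter P? rest)
      ≡⟨ cong₂ _+_ (length-filter-map P? (f zero ,_) ys) (length-filter-cartesianProduct P? (f ∘ suc) ys) ⟩
    sum (λ i → length (filter (λ y → P? (f i , y)) ys))               ∎
    where rest = cartesianProduct (tabulate (f ∘ suc)) ys

module DegreeInA₁ where

  open Counting
  open import Level using (0ℓ)
  open import Data.Nat using (suc; _+_; _*_; _≟_)
  open import Data.Nat.Properties using (+-*-semiring; +-assoc; +-identityʳ; +-cancelˡ-≡; m+n≡0⇒m≡0; suc-injective)
  open import Data.Nat.Tactic.RingSolver using (solve-∀)
  open import Data.Fin renaming (_≟_ to _≟ᶠ_) using ()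
  open import Data.List using (allFin)
  open import Data.Product using (_,_; proj₁; proj₂)
  open import Data.Sum using (_⊎_; inj₁; inj₂; swap)
  open import Function using (id; _∘_)
  open import Relation.Nullary using (Dec; ¬_; contradiction)
  open import Relation.Nullary.Decidable using (_×-dec_; ¬?)
  open import Relation.Unary using (Pred; Decidable)
  open import Relation.Unary.Properties using (_∩?_; ∁?)
  open import Relation.Binary.PropositionalEquality
    using (_≢_; refl; sym; trans; cong; cong₂; subst; module ≡-Reasoning)
  open import Algebra.Properties.Semiring.Sum +-*-semiring using (sum; sum-cong-≗)

  open ≡-Reasoning

  module _ {n : ℕ} (G : Graph n) where
    open Graph G renaming (sym to adj-sym)

    adj⇒≢ : ∀ {x y} → Adj x y → x ≢ y
    adj⇒≢ axy x≡y = irrefl (subst (Adj _) (sym x≡y) axy)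

    Pendant : Pred (Fin n) 0ℓ
    Pendant x = deg G x ≡ 1

    pendant? : Decidable Pendant
    pendant? x = deg G x ≟ 1

    deg≡count : (x : Fin n) → deg G x ≡ count (adj? x)
    deg≡count x = length-filter-tabulate (adj? x) id

    deg≡count-in : (x : Fin n) → deg G x ≡ count (λ y → adj? y x)
    deg≡count-in x = trans (deg≡count x) (count-cong (adj? x) (λ y → adj? y x) (adj-sym , adj-sym))

    deg≡suc-count-others : ∀ {x y} → Adj x y → deg G x ≡ suc (count (adj? x ∩? ∁? (_≟ᶠ y)))
    deg≡suc-count-others {x} {y} axy = begin
      deg G x                                                        ≡⟨ deg≡count x ⟩
      count (adj? x)                                                 ≡⟨ count-split (adj? x) (_≟ᶠ y) ⟩
      count (adj? x ∩? (_≟ᶠ y)) + count (adj? x ∩? ∁? (_≟ᶠ y))       ≡⟨ cong (_+ count (adj? x ∩? ∁? (_≟ᶠ y))) y-counts-once ⟩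
      suc (count (adj? x ∩? ∁? (_≟ᶠ y)))                             ∎
      where
      y-counts-once : count (adj? x ∩? (_≟ᶠ y)) ≡ 1
      y-counts-once = trans (count-∩-≡ (adj? x) y) (𝟙-yes (adj? x y) axy)

    shuntable⇒¬pendant : ∀ {x y} → Adj x y → Shuntable G x y → ¬ Pendant y
    shuntable⇒¬pendant {x} {y} axy (w , w≢x , ayw) pendant =
      count-≢0 (adj? y ∩? ∁? (_≟ᶠ x)) (ayw , w≢x)
        (suc-injective (trans (sym (deg≡suc-count-others (adj-sym axy))) pendant))

    ¬pendant⇒shuntable : ∀ {x y} → Adj x y → ¬ Pendant y → Shuntable G x y
    ¬pendant⇒shuntable {x} {y} axy ¬pendant with count≢0⇒∃ (adj? y ∩? ∁? (_≟ᶠ x)) others≢0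
      where
      others≢0 : count (adj? y ∩? ∁? (_≟ᶠ x)) ≢ 0
      others≢0 none = ¬pendant (trans (deg≡suc-count-others (adj-sym axy)) (cong suc none))
    ... | w , ayw , w≢x = w , w≢x , ayw

    pendantNbr? : (u v : Fin n) → Decidable (λ x → Adj u x × x ≢ v × Pendant x)
    pendantNbr? u v x = adj? u x ×-dec ¬? (x ≟ᶠ v) ×-dec pendant? x

    pendantNbrs≡count : (u v : Fin n) → pendantNbrs G u v ≡ count (pendantNbr? u v)
    pendantNbrs≡count u v = length-filter-tabulate (pendantNbr? u v) id

    Arc : Fin n → Fin n → Set
    Arc x y = Adj x y × ¬ Pendant y

    arc? : (x y : Fin n) → Dec (Arc x y)
    arc? x y = adj? x y ×-dec ¬? (pendant? y)

    A1Vertex⇒Arc : ∀ {x y} → A1Vertex G x y → Arc x y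
    A1Vertex⇒Arc (axy , shuntable) = axy , shuntable⇒¬pendant axy shuntable

    Arc⇒A1Vertex : ∀ {x y} → Arc x y → A1Vertex G x y
    Arc⇒A1Vertex (axy , ¬pendant) = axy , ¬pendant⇒shuntable axy ¬pendant

    module _ (u v : Fin n) where

      neighbour? : (x : Fin n) → Decidable (λ y → A1Neighbour G u v (x , y))
      neighbour? x y = a1Neighbour? G u v (x , y)

      neighboursFrom : Fin n → ℕ
      neighboursFrom x = count (neighbour? x)

      degA1≡∑neighboursFrom : degA1 G u v ≡ sum neighboursFrom
      degA1≡∑neighboursFrom =
        trans (length-filter-cartesianProduct (a1Neighbour? G u v) id (allFin n))
              (sum-cong-≗ λ x → length-filter-tabulate (neighbour? x) id)

      neighboursFrom-tail : Adj u v → deg G u ≡ suc (pendantNbrs G u v + neighboursFrom u)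
      neighboursFrom-tail auv = begin
        deg G u                                    ≡⟨ deg≡suc-count-others auv ⟩
        suc (count others)                         ≡⟨ cong suc (count-split others pendant?) ⟩
        suc (count (others ∩? pendant?) + count (others ∩? ∁? pendant?))
          ≡⟨ cong suc (cong₂ _+_ pendants nonPendants) ⟩
        suc (pendantNbrs G u v + neighboursFrom u) ∎
        where
        others = adj? u ∩? ∁? (_≟ᶠ v)

        pendants : count (others ∩? pendant?) ≡ pendantNbrs G u v
        pendants = trans
          (count-cong (others ∩? pendant?) (pendantNbr? u v)
            ((λ ((auy , y≢v) , p) → auy , y≢v , p) , (λ (auy , y≢v , p) → (auy , y≢v) , p)))
          (sym (pendantNbrs≡count u v))

        nonPendants : count (others ∩? ∁? pendant?) ≡ neighboursFrom u
        nonPendants = count-cong (others ∩? ∁? pendant?) (neighbour? u)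
          ( (λ ((auy , y≢v) , ¬p) → Arc⇒A1Vertex (auy , ¬p) , (λ (_ , y≡v) → y≢v y≡v) , inj₁ (inj₁ refl))
          , (λ (vertex , ≢uv , _) → let auy , ¬p = A1Vertex⇒Arc vertex in (auy , λ y≡v → ≢uv (refl , y≡v)) , ¬p))

      neighboursFrom-head : Adj u v → deg G v ≡ 𝟙 (pendant? u) + pendantNbrs G v u + neighboursFrom v
      neighboursFrom-head auv = begin
        deg G v                                                    ≡⟨ deg≡count v ⟩
        count (adj? v)                                             ≡⟨ count-split (adj? v) pendant? ⟩
        count pendants + count (adj? v ∩? ∁? pendant?)
          ≡⟨ cong₂ _+_ (count-split pendants (_≟ᶠ u)) nonPendants ⟩
        count (pendants ∩? (_≟ᶠ u)) + count (pendants ∩? ∁? (_≟ᶠ u)) + neighboursFrom v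
          ≡⟨ cong (_+ neighboursFrom v) (cong₂ _+_ pendant-u pendants-≢u) ⟩
        𝟙 (pendant? u) + pendantNbrs G v u + neighboursFrom v      ∎
        where
        pendants = adj? v ∩? pendant?

        pendant-u : count (pendants ∩? (_≟ᶠ u)) ≡ 𝟙 (pendant? u)
        pendant-u = trans (count-∩-≡ pendants u) (𝟙-cong (pendants u) (pendant? u) proj₂ (adj-sym auv ,_))

        pendants-≢u : count (pendants ∩? ∁? (_≟ᶠ u)) ≡ pendantNbrs G v u
        pendants-≢u = trans
          (count-cong (pendants ∩? ∁? (_≟ᶠ u)) (pendantNbr? v u)
            ((λ ((avy , p) , y≢u) → avy , y≢u , p) , (λ (avy , y≢u , p) → (avy , p) , y≢u)))
          (sym (pendantNbrs≡count v u))

        nonPendants : count (adj? v ∩? ∁? pendant?) ≡ neighboursFrom v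
        nonPendants = count-cong (adj? v ∩? ∁? pendant?) (neighbour? v)
          ( (λ arc → Arc⇒A1Vertex arc , (λ (v≡u , _) → adj⇒≢ auv (sym v≡u)) , inj₁ (inj₂ refl))
          , (λ (vertex , _) → A1Vertex⇒Arc vertex))

      neighboursFrom-other : ¬ Pendant v → u ≢ v → ∀ {x} → x ≢ u → x ≢ v →
        neighboursFrom x + 𝟙 (pendant? u) * 𝟙 (adj? x u) ≡ 𝟙 (adj? x v) + 𝟙 (adj? x u)
      neighboursFrom-other ¬pendant-v u≢v {x} x≢u x≢v = begin
        neighboursFrom x + p * 𝟙 (adj? x u)                         ≡⟨ cong (_+ p * 𝟙 (adj? x u)) heads ⟩
        𝟙 (neighbour? x v) + 𝟙 (neighbour? x u) + p * 𝟙 (adj? x u)  ≡⟨ cong₂ (λ a b → a + b + p * 𝟙 (adj? x u)) to-v to-u ⟩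
        𝟙 (adj? x v) + 𝟙 (arc? x u) + p * 𝟙 (adj? x u)              ≡⟨ +-assoc (𝟙 (adj? x v)) _ _ ⟩
        𝟙 (adj? x v) + (𝟙 (arc? x u) + p * 𝟙 (adj? x u))            ≡⟨ cong (𝟙 (adj? x v) +_) (𝟙-×-¬ (adj? x u) (pendant? u)) ⟩
        𝟙 (adj? x v) + 𝟙 (adj? x u)                                 ∎
        where
        p = 𝟙 (pendant? u)

        headIn : ∀ {y} → A1Neighbour G u v (x , y) → y ≡ v ⊎ y ≡ u
        headIn (_ , _ , inj₁ (inj₁ x≡u)) = contradiction x≡u x≢u
        headIn (_ , _ , inj₁ (inj₂ x≡v)) = contradiction x≡v x≢v
        headIn (_ , _ , inj₂ y∈uv)       = swap y∈uv

        heads : neighboursFrom x ≡ 𝟙 (neighbour? x v) + 𝟙 (neighbour? x u)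
        heads = count-two-points (neighbour? x) (u≢v ∘ sym) headIn

        toNeighbour : ∀ {y} → Arc x y → y ≡ u ⊎ y ≡ v → A1Neighbour G u v (x , y)
        toNeighbour arc y∈uv = Arc⇒A1Vertex arc , (λ (x≡u , _) → x≢u x≡u) , inj₂ y∈uv

        to-v : 𝟙 (neighbour? x v) ≡ 𝟙 (adj? x v)
        to-v = 𝟙-cong (neighbour? x v) (adj? x v) (proj₁ ∘ proj₁) (λ axv → toNeighbour (axv , ¬pendant-v) (inj₂ refl))

        to-u : 𝟙 (neighbour? x u) ≡ 𝟙 (arc? x u)
        to-u = 𝟙-cong (neighbour? x u) (arc? x u) (A1Vertex⇒Arc ∘ proj₁) (λ arc → toNeighbour arc (inj₁ refl))

      degA1-split : u ≢ v → degA1 G u v ≡ neighboursFrom u + neighboursFrom v + ∑-except u v neighboursFrom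
      degA1-split u≢v = trans degA1≡∑neighboursFrom (∑-remove-two u≢v neighboursFrom)

      deg-tail-split : Adj u v → deg G u ≡ 1 + ∑-except u v (λ x → 𝟙 (adj? x u))
      deg-tail-split auv = begin
        deg G u              ≡⟨ deg≡count-in u ⟩
        sum A                ≡⟨ ∑-remove-two (adj⇒≢ auv) A ⟩
        A u + A v + ∑-except u v A
          ≡⟨ cong₂ (λ a b → a + b + ∑-except u v A) (𝟙-no (adj? u u) irrefl) (𝟙-yes (adj? v u) (adj-sym auv)) ⟩
        1 + ∑-except u v A   ∎
        where
        A : Fin n → ℕ
        A x = 𝟙 (adj? x u)

      deg-head-split : Adj u v → deg G v ≡ 1 + ∑-except u v (λ x → 𝟙 (adj? x v))
      deg-head-split auv = begin
        deg G v              ≡⟨ deg≡count-in v ⟩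
        sum B                ≡⟨ ∑-remove-two (adj⇒≢ auv) B ⟩
        B u + B v + ∑-except u v B
          ≡⟨ cong₂ (λ a b → a + b + ∑-except u v B) (𝟙-yes (adj? u v) auv) (𝟙-no (adj? v v) irrefl) ⟩
        1 + ∑-except u v B   ∎
        where
        B : Fin n → ℕ
        B x = 𝟙 (adj? x v)

      ∑-except-neighboursFrom : A1Vertex G u v →
        let A = λ x → 𝟙 (adj? x u) ; B = λ x → 𝟙 (adj? x v) in
        ∑-except u v neighboursFrom + 𝟙 (pendant? u) * ∑-except u v A ≡ ∑-except u v B + ∑-except u v A
      ∑-except-neighboursFrom (auv , shuntable) = begin
        Σ F + p * Σ A                ≡⟨ cong (Σ F +_) (∑-except-* p A) ⟨
        Σ F + Σ (λ x → p * A x)      ≡⟨ ∑-except-+ F (λ x → p * A x) ⟨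
        Σ (λ x → F x + p * A x)      ≡⟨ ∑-except-cong (λ _ → neighboursFrom-other ¬pendant-v (adj⇒≢ auv)) ⟩
        Σ (λ x → B x + A x)          ≡⟨ ∑-except-+ B A ⟩
        Σ B + Σ A                    ∎
        where
        Σ = ∑-except u v
        F = neighboursFrom
        p = 𝟙 (pendant? u)
        A B : Fin n → ℕ
        A x = 𝟙 (adj? x u)
        B x = 𝟙 (adj? x v)
        ¬pendant-v = shuntable⇒¬pendant auv shuntable

      degA1-identity : A1Vertex G u v →
        degA1 G u v + (pendantNbrs G u v + pendantNbrs G v u + 3) + 𝟙 (pendant? u) * deg G u
          ≡ deg G u + deg G v + (deg G u + deg G v)
      degA1-identity vertex@(auv , _) = begin
        D + (mᵤ + mᵥ + 3) + p * dᵤ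
          ≡⟨ cong₂ (λ d e → d + (mᵤ + mᵥ + 3) + p * e) (degA1-split (adj⇒≢ auv)) (deg-tail-split auv) ⟩
        F u + F v + Σ F + (mᵤ + mᵥ + 3) + p * (1 + Σ A)
          ≡⟨ regroup (F u) (F v) (Σ F) (Σ A) mᵤ mᵥ p ⟩
        suc (mᵤ + F u) + (p + mᵥ + F v) + (Σ F + p * Σ A) + 2
          ≡⟨ cong₂ (λ a b → a + b + (Σ F + p * Σ A) + 2) (neighboursFrom-tail auv) (neighboursFrom-head auv) ⟨
        dᵤ + dᵥ + (Σ F + p * Σ A) + 2
          ≡⟨ cong (λ c → dᵤ + dᵥ + c + 2) (∑-except-neighboursFrom vertex) ⟩
        dᵤ + dᵥ + (Σ B + Σ A) + 2
          ≡⟨ regroup′ dᵤ dᵥ (Σ A) (Σ B) ⟩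
        dᵤ + dᵥ + ((1 + Σ A) + (1 + Σ B))
          ≡⟨ cong₂ (λ a b → dᵤ + dᵥ + (a + b)) (deg-tail-split auv) (deg-head-split auv) ⟨
        dᵤ + dᵥ + (dᵤ + dᵥ)  ∎
        where
        D = degA1 G u v
        dᵤ = deg G u
        dᵥ = deg G v
        mᵤ = pendantNbrs G u v
        mᵥ = pendantNbrs G v u
        p = 𝟙 (pendant? u)
        F = neighboursFrom
        Σ = ∑-except u v
        A B : Fin n → ℕ
        A x = 𝟙 (adj? x u)
        B x = 𝟙 (adj? x v)

        regroup : ∀ fᵤ fᵥ σF σA mᵤ mᵥ p →
          fᵤ + fᵥ + σF + (mᵤ + mᵥ + 3) + p * (1 + σA) ≡ suc (mᵤ + fᵤ) + (p + mᵥ + fᵥ) + (σF + p * σA) + 2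
        regroup = solve-∀

        regroup′ : ∀ dᵤ dᵥ σA σB → dᵤ + dᵥ + (σB + σA) + 2 ≡ dᵤ + dᵥ + ((1 + σA) + (1 + σB))
        regroup′ = solve-∀

      degA1-nonpendant : A1Vertex G u v → ¬ Pendant u →
        degA1 G u v + (pendantNbrs G u v + pendantNbrs G v u + 3) ≡ deg G u + deg G v + (deg G u + deg G v)
      degA1-nonpendant vertex ¬pendant-u = begin
        D + m                         ≡⟨ +-identityʳ (D + m) ⟨
        D + m + 0 * deg G u           ≡⟨ cong (λ p → D + m + p * deg G u) (𝟙-no (pendant? u) ¬pendant-u) ⟨
        D + m + 𝟙 (pendant? u) * deg G u   ≡⟨ degA1-identity vertex ⟩
        deg G u + deg G v + (deg G u + deg G v) ∎
        where
        D = degA1 G u v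
        m = pendantNbrs G u v + pendantNbrs G v u + 3

      pendantNbrs-of-pendant : Adj u v → Pendant u → pendantNbrs G u v ≡ 0
      pendantNbrs-of-pendant auv pendant-u =
        m+n≡0⇒m≡0 (pendantNbrs G u v) (suc-injective (trans (sym (neighboursFrom-tail auv)) pendant-u))

      degA1-pendant : A1Vertex G u v → Pendant u →
        degA1 G u v + (pendantNbrs G v u + 2) ≡ deg G v + deg G v
      degA1-pendant (auv , shuntable) pendant-u = +-cancelˡ-≡ 2 _ _ (begin
        2 + (D + (mᵥ + 2))                                            ≡⟨ shift D mᵥ ⟩
        D + (0 + mᵥ + 3) + 1 * 1                                      ≡⟨ cong₂ (λ m p → D + (m + mᵥ + 3) + p * 1) mᵤ≡0 p≡1 ⟨
        D + (pendantNbrs G u v + mᵥ + 3) + 𝟙 (pendant? u) * 1         ≡⟨ cong (λ d → D + (pendantNbrs G u v + mᵥ + 3) + 𝟙 (pendant? u) * d) pendant-u ⟨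
        D + (pendantNbrs G u v + mᵥ + 3) + 𝟙 (pendant? u) * deg G u   ≡⟨ degA1-identity (auv , shuntable) ⟩
        deg G u + dᵥ + (deg G u + dᵥ)                                 ≡⟨ cong (λ d → d + dᵥ + (d + dᵥ)) pendant-u ⟩
        1 + dᵥ + (1 + dᵥ)                                             ≡⟨ shift′ dᵥ ⟩
        2 + (dᵥ + dᵥ)                                                 ∎)
        where
        D = degA1 G u v
        mᵥ = pendantNbrs G v u
        dᵥ = deg G v
        mᵤ≡0 = pendantNbrs-of-pendant auv pendant-u
        p≡1 = 𝟙-yes (pendant? u) pendant-u

        shift : ∀ d m → 2 + (d + (m + 2)) ≡ d + (0 + m + 3) + 1 * 1
        shift = solve-∀

        shift′ : ∀ d → 1 + d + (1 + d) ≡ 2 + (d + d)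
        shift′ = solve-∀

open DegreeInA₁
open import Data.Integer using (ℤ; +_; _+_; _-_; _*_)
open import Data.Integer.Tactic.RingSolver using (solve-∀)
open import Data.Nat.Properties using (<-irrefl)
open import Data.Product using (_,_)
open import Relation.Binary.PropositionalEquality using (sym; cong; module ≡-Reasoning)

open ≡-Reasoning

x≡x+y-y : ∀ x y → x ≡ x + y - y
x≡x+y-y = solve-∀

nonpendant-formula : (D mᵤ mᵥ dᵤ dᵥ : ℤ) → D + (mᵤ + mᵥ + + 3) ≡ dᵤ + dᵥ + (dᵤ + dᵥ) →
                     D ≡ + 2 * (dᵤ + dᵥ - + 2) - (mᵤ + mᵥ) + + 1
nonpendant-formula D mᵤ mᵥ dᵤ dᵥ eq = begin
  D                                          ≡⟨ x≡x+y-y D (mᵤ + mᵥ + + 3) ⟩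
  D + (mᵤ + mᵥ + + 3) - (mᵤ + mᵥ + + 3)      ≡⟨ cong (_- (mᵤ + mᵥ + + 3)) eq ⟩
  dᵤ + dᵥ + (dᵤ + dᵥ) - (mᵤ + mᵥ + + 3)      ≡⟨ expand mᵤ mᵥ dᵤ dᵥ ⟩
  + 2 * (dᵤ + dᵥ - + 2) - (mᵤ + mᵥ) + + 1   ∎
  where
  expand : ∀ mᵤ mᵥ dᵤ dᵥ → dᵤ + dᵥ + (dᵤ + dᵥ) - (mᵤ + mᵥ + + 3) ≡ + 2 * (dᵤ + dᵥ - + 2) - (mᵤ + mᵥ) + + 1
  expand = solve-∀

pendant-formula : (D mᵥ dᵥ : ℤ) → D + (mᵥ + + 2) ≡ dᵥ + dᵥ → D ≡ + 2 * (dᵥ - + 1) - mᵥ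
pendant-formula D mᵥ dᵥ eq = begin
  D                            ≡⟨ x≡x+y-y D (mᵥ + + 2) ⟩
  D + (mᵥ + + 2) - (mᵥ + + 2)  ≡⟨ cong (_- (mᵥ + + 2)) eq ⟩
  dᵥ + dᵥ - (mᵥ + + 2)         ≡⟨ expand mᵥ dᵥ ⟩
  + 2 * (dᵥ - + 1) - mᵥ        ∎
  where
  expand : ∀ mᵥ dᵥ → dᵥ + dᵥ - (mᵥ + + 2) ≡ + 2 * (dᵥ - + 1) - mᵥ
  expand = solve-∀

mainTheorem7 : (n : ℕ) (G : Graph n) → 3 ≤ n → Connected G →
    (u v : Fin n) → A1Vertex G u v →
    ((1 < deg G u → 1 < deg G v →
        + degA1 G u v ≡ + 2 * (+ deg G u + + deg G v - + 2)
                          - (+ pendantNbrs G u v + + pendantNbrs G v u) + + 1)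
    × (deg G u ≡ 1 →
        + degA1 G u v ≡ + 2 * (+ deg G v - + 1) - + pendantNbrs G v u))
-- On non-negative integers ℤ addition computes, so `cong +_` turns the ℕ identities into the
-- hypotheses of the two formulas.
mainTheorem7 n G _ _ u v vertex =
    (λ 1<dᵤ _ → nonpendant-formula (+ degA1 G u v) (+ pendantNbrs G u v) (+ pendantNbrs G v u) (+ deg G u) (+ deg G v)
                  (cong +_ (degA1-nonpendant G u v vertex (λ dᵤ≡1 → <-irrefl (sym dᵤ≡1) 1<dᵤ))))
  , (λ pendant-u → pendant-formula (+ degA1 G u v) (+ pendantNbrs G v u) (+ deg G v)
                  (cong +_ (degA1-pendant G u v vertex pendant-u)))
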